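{- Let $(I,=_I,\neq_I;K)$ be a completely separated set and $S=(\lambda_0,\lambda_1;\phi_0,\phi_1)$ a family of completely separated sets indexed by it. Let $\prod_{i\in I}\lambda_0(i)$ be the Pi-set with its pointwise equality and inequality, and let $\bigotimes_{i\in I}F_i:=\{f_i\circ\mathrm{pr}_i\mid i\in I,\ f_i\in F_i\}$, where $\mathrm{pr}_i(\Theta):=\Theta_i$. Then $\big(\prod_{i\in I}\lambda_0(i),=_{\prod},\neq_{\prod};\bigotimes_{i\in I}F_i\big)$ is a completely separated set; in particular $\Theta\neq_{\prod}\Theta'\Leftrightarrow\Theta\neq_{(\prod_{i\in I}\lambda_0(i),\bigotimes_{i\in I}F_i)}\Theta'$.
   Context: Constructive (Bishop-style) setting. Sets have equalities, functions preserve them; $\mathbb F(X)$ is the set of real-valued functions on $X$ with pointwise equality; an extensional subset $F\subseteq\mathbb F(X)$ is given by a property stable under equality. $a\neq_{\mathbb R}b$ iff $|a-b|>0$. For extensional $F\subseteq\mathbb F(X)$: $x=_{(X,F)}x'$ iff $\forall f\in F\,f(x)=f(x')$; $x\neq_{(X,F)}x'$ iff $\exists f\in F\,f(x)\neq_{\mathbb R}f(x')$; tightness means $x=_{(X,F)}x'\Rightarrow x=_Xx'$. A set with an inequality is $(X,=_X,\neq_X)$ where $x=_Xy$ and $x\neq_Xy$ are contradictory; a function between such sets is strongly extensional if $f(x)\neq f(y)\Rightarrow x\neq y$. A completely separated set $(X,=_X,\neq_X;F)$: $F$ extensional subset of $\mathbb F(X)$, $\neq_X$ equivalent to $\neq_{(X,F)}$,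 and $\neq_{(X,F)}$ tight. A family of completely separated sets indexed by a completely separated set $(I,=_I,\neq_I;K)$ consists of: for each $i\in I$ a set with an inequality $(\lambda_0(i),=_{\lambda_0(i)},\neq_{\lambda_0(i)})$ and an extensional subset $F_i\subseteq\mathbb F(\lambda_0(i))$; for each $i=_Ij$ a strongly extensional function $\lambda_{ij}:\lambda_0(i)\to\lambda_0(j)$ with $\lambda_{ii}=\mathrm{id}$ and $\lambda_{jk}\circ\lambda_{ij}=\lambda_{ik}$ when $i=_Ij=_Ik$, and a function $\phi_{ij}:F_i\to F_j$; such that (a) $\neq_{\lambda_0(i)}$ is equivalent to $\neq_{(\lambda_0(i),F_i)}$, (b) $x=_{(\lambda_0(i),F_i)}x'\Rightarrow x=_{\lambda_0(i)}x'$, and (c) $\phi_{ij}(f_i)=f_i\circ\lambda_{ji}$ for $f_i\in F_i$ when $i=_Ij$. The Pi-set $\prod_{i\in I}\lambda_0(i)$ consists of dependent assignments $\Theta$ with $\Theta_i\in\lambda_0(i)$ for all $i$ and $\Theta_j=_{\lambda_0(j)}\lambda_{ij}(\Theta_i)$ whenever $i=_Ij$; $\Theta=_{\prod}\Theta'$ iff $\Theta_i=\Theta'_i$ for all $i$, and $\Theta\neq_{\prod}\Theta'$ iff $\Theta_i\neq_{\lambda_0(i)}\Theta'_i$ for some $i$. -}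

module Defs where

open import Level using (0ℓ)
open import Data.Nat using (ℕ; suc; _*_)
open import Data.Integer using (+_)
open import Data.Rational using (ℚ; _-_; _+_; ∣_∣; _≤_; _<_; _/_)
open import Data.Product using (Σ; ∃; ∃-syntax; _×_; _,_; proj₁; proj₂)
open import Data.Empty using (⊥)
open import Function using (_⇔_)
open import Relation.Binary.Bundles using (Setoid)
open import Relation.Binary.Structures using (IsEquivalence)

-- Bishop's constructive reals: regular sequences of rationals.
-- Index n stands for Bishop's index n+1, i.e. precision 1/(n+1).

record ℝ : Set where
  field
    seq : ℕ → ℚ
    reg : ∀ m n → ∣ seq m - seq n ∣ ≤ (+ 1 / suc m) + (+ 1 / suc n)
open ℝ public

_=ℝ_ : ℝ → ℝ → Set
x =ℝ y = ∀ n → ∣ seq x n - seq y n ∣ ≤ + 2 / suc n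

-- a ≠ℝ b  iff  |a - b| > 0.  Unfolded: (a - b)_n = a_{2n} - b_{2n} (Bishop
-- indexing), |z|_n = |z_n|, and z > 0 iff ∃ n. z_n > 1/n.  In our 0-based
-- indexing Bishop's index 2n corresponds to 2k+1 when n = k+1.
_≠ℝ_ : ℝ → ℝ → Set
a ≠ℝ b = ∃[ k ] (+ 1 / suc k < ∣ seq a (suc (2 * k)) - seq b (suc (2 * k)) ∣)

record SetIneq : Set₁ where
  field
    setoid : Setoid 0ℓ 0ℓ
  open Setoid setoid public
  field
    _≠_     : Carrier → Carrier → Set
    ≠-contr : ∀ {x y} → x ≈ y → x ≠ y → ⊥

record RFun (X : Setoid 0ℓ 0ℓ) : Set where
  open Setoid X
  field
    ap  : Carrier → ℝ
    ext : ∀ {x y} → x ≈ y → ap x =ℝ ap y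
open RFun public

_=𝔽_ : {X : Setoid 0ℓ 0ℓ} → RFun X → RFun X → Set
_=𝔽_ {X} f g = ∀ (x : Setoid.Carrier X) → ap f x =ℝ ap g x

IsExtensional : {X : Setoid 0ℓ 0ℓ} → (RFun X → Set) → Set
IsExtensional {X} P = ∀ (f g : RFun X) → f =𝔽 g → P f → P g

record ExtSubset (X : Setoid 0ℓ 0ℓ) : Set₁ where
  field
    mem      : RFun X → Set
    mem-ext  : IsExtensional mem
open ExtSubset public

module _ {X : Setoid 0ℓ 0ℓ} (P : RFun X → Set) where
  open Setoid X
  EqF : Carrier → Carrier → Set
  EqF x x' = ∀ f → P f → ap f x =ℝ ap f x'
  NeqF : Carrier → Carrier → Set
  NeqF x x' = ∃[ f ] (P f × (ap f x ≠ℝ ap f x'))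

IsCompletelySeparated : (X : SetIneq) → (RFun (SetIneq.setoid X) → Set) → Set
IsCompletelySeparated X P =
  IsExtensional P
  × (∀ x y → (x ≠ y) ⇔ (NeqF P x y))
  × (∀ x y → EqF P x y → x ≈ y)
  where open SetIneq X

record CompletelySeparated : Set₁ where
  field
    carrier : SetIneq
    F       : ExtSubset (SetIneq.setoid carrier)
    compSep : IsCompletelySeparated carrier (mem F)
  open SetIneq carrier public

record Family (I : CompletelySeparated) : Set₁ where
  module I = CompletelySeparated I
  field
    λ₀ : I.Carrier → SetIneq
  module λ₀ (i : I.Carrier) = SetIneq (λ₀ i)
  field
    F  : (i : I.Carrier) → ExtSubset (λ₀.setoid i)
    λ₁ : ∀ {i j} → i I.≈ j → λ₀.Carrier i → λ₀.Carrier j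
    λ₁-ext : ∀ {i j} (p : i I.≈ j) {x y} → λ₀._≈_ i x y → λ₀._≈_ j (λ₁ p x) (λ₁ p y)
    λ₁-sext : ∀ {i j} (p : i I.≈ j) {x y} → λ₀._≠_ j (λ₁ p x) (λ₁ p y) → λ₀._≠_ i x y
    λ₁-id : ∀ {i} (p : i I.≈ i) x → λ₀._≈_ i (λ₁ p x) x
    λ₁-comp : ∀ {i j k} (p : i I.≈ j) (q : j I.≈ k) (r : i I.≈ k) x →
              λ₀._≈_ k (λ₁ q (λ₁ p x)) (λ₁ r x)
    φ  : ∀ {i j} → i I.≈ j → (f : RFun (λ₀.setoid i)) → mem (F i) f → RFun (λ₀.setoid j)
    φ-mem : ∀ {i j} (p : i I.≈ j) f (fi : mem (F i) f) → mem (F j) (φ p f fi)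
    φ-eq : ∀ {i j} (p : i I.≈ j) f (fi : mem (F i) f) (x : λ₀.Carrier j) →
           ap (φ p f fi) x =ℝ ap f (λ₁ (I.sym p) x)
    sep : ∀ i x y → (λ₀._≠_ i x y) ⇔ (NeqF (mem (F i)) x y)
    tight : ∀ i x y → EqF (mem (F i)) x y → λ₀._≈_ i x y

module PiSet {I : CompletelySeparated} (S : Family I) where
  open Family S

  record Π-el : Set where
    field
      Θ   : (i : I.Carrier) → λ₀.Carrier i
      Θ-dep : ∀ {i j} (p : i I.≈ j) → λ₀._≈_ j (Θ j) (λ₁ p (Θ i))
  open Π-el public

  _=Π_ : Π-el → Π-el → Set
  a =Π b = ∀ i → λ₀._≈_ i (Θ a i) (Θ b i)

  _≠Π_ : Π-el → Π-el → Set
  a ≠Π b = ∃[ i ] λ₀._≠_ i (Θ a i) (Θ b i)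

  Π-setoid : Setoid 0ℓ 0ℓ
  Π-setoid = record
    { Carrier = Π-el
    ; _≈_ = _=Π_
    ; isEquivalence = record
      { refl  = λ i → λ₀.refl i
      ; sym   = λ p i → λ₀.sym i (p i)
      ; trans = λ p q i → λ₀.trans i (p i) (q i)
      }
    }

  ΠSet : SetIneq
  ΠSet = record
    { setoid = Π-setoid
    ; _≠_ = _≠Π_
    ; ≠-contr = λ { eq (i , ne) → λ₀.≠-contr i (eq i) ne }
    }

  pr : (i : I.Carrier) → Π-el → λ₀.Carrier i
  pr i a = Θ a i

  comp-pr : (i : I.Carrier) → RFun (λ₀.setoid i) → RFun Π-setoid
  comp-pr i f = record { ap = λ a → ap f (pr i a) ; ext = λ eq → ext f (eq i) }

  ⊗F : RFun Π-setoid → Set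
  ⊗F g = ∃[ i ] ∃[ f ] (mem (F i) f × (g =𝔽 comp-pr i f))

-- The product inequality and the one induced by ⊗F both live in a single coordinate i, where they
-- agree by the complete separation of λ₀(i); tightness is likewise checked coordinatewise. The one
-- piece of real analysis needed is that apartness of Bishop reals respects their equality, so that
-- a function in ⊗F, which is only pointwise equal to some fᵢ ∘ prᵢ, separates as fᵢ does.
module Submission where

open import Data.Nat as ℕ using (ℕ; suc)
import Data.Nat.Properties as ℕ
import Data.Nat.Solver as ℕ-Solver
open import Data.Integer as ℤ using (+_; +[1+_])
import Data.Integer.Properties as ℤ
open import Data.Rational
open import Data.Rational.Properties
import Data.Rational.Solver as ℚ-Solver
open import Data.Rational.Unnormalised as ℚᵘ using (mkℚᵘ; *≡*; *<*)
import Data.Rational.Unnormalised.Properties as ℚᵘ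
open import Data.Product using (∃-syntax; _,_)
open import Function.Bundles using (Equivalence; mk⇔)
open import Relation.Binary.PropositionalEquality
open import Relation.Nullary.Decidable using (decidable-stable)

open import Defs

infix 8 _/1+_

_/1+_ : ℕ → ℕ → ℚ
c /1+ n = + c / suc n

fromℚᵘ-homo-* : ∀ p q → fromℚᵘ (p ℚᵘ.* q) ≡ fromℚᵘ p * fromℚᵘ q
fromℚᵘ-homo-* p q = toℚᵘ-injective (begin
  toℚᵘ (fromℚᵘ (p ℚᵘ.* q))              ≈⟨ toℚᵘ-fromℚᵘ (p ℚᵘ.* q) ⟩
  p ℚᵘ.* q                               ≈⟨ ℚᵘ.*-cong (toℚᵘ-fromℚᵘ p) (toℚᵘ-fromℚᵘ q) ⟨
  toℚᵘ (fromℚᵘ p) ℚᵘ.* toℚᵘ (fromℚᵘ q)   ≈⟨ toℚᵘ-homo-* (fromℚᵘ p) (fromℚᵘ q) ⟨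
  toℚᵘ (fromℚᵘ p * fromℚᵘ q)             ∎)
  where open ℚᵘ.≃-Reasoning

-- Writing every c/(n+1) as a constant multiple of 1/(n+1) turns the bookkeeping of error
-- terms into ring identities that the solver checks.
/1+-scale : ∀ c n → c /1+ n ≡ (+ c / 1) * 1 /1+ n
/1+-scale c n = trans (fromℚᵘ-cong {mkℚᵘ (+ c) n} {mkℚᵘ (+ c) 0 ℚᵘ.* mkℚᵘ (+ 1) n} (*≡* eq))
                      (fromℚᵘ-homo-* (mkℚᵘ (+ c) 0) (mkℚᵘ (+ 1) n))
  where
  eq : + c ℤ.* + (1 ℕ.* suc n) ≡ (+ c ℤ.* + 1) ℤ.* + suc n
  eq = cong₂ ℤ._*_ (sym (ℤ.*-identityʳ (+ c))) (cong +_ (ℕ.*-identityˡ (suc n)))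

/1+-halve : ∀ c n → (2 ℕ.* c) /1+ suc (2 ℕ.* n) ≡ c /1+ n
/1+-halve c n = fromℚᵘ-cong {mkℚᵘ (+ (2 ℕ.* c)) (suc (2 ℕ.* n))} {mkℚᵘ (+ c) n}
  (*≡* (trans (sym (ℤ.pos-* (2 ℕ.* c) (suc n))) (trans (cong +_ eq) (ℤ.pos-* c _))))
  where
  open ℕ-Solver.+-*-Solver
  eq : 2 ℕ.* c ℕ.* suc n ≡ c ℕ.* suc (suc (2 ℕ.* n))
  eq = solve 2 (λ c n → con 2 :* c :* (con 1 :+ n) := c :* (con 2 :+ con 2 :* n)) refl c n

0≤/1+ : ∀ c n → 0ℚ ≤ c /1+ n
0≤/1+ c n = nonNegative⁻¹ (c /1+ n) {{normalize-nonNeg c (suc n)}}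

/1+-<-pos : ∀ c p → Positive p → ∃[ m ] c /1+ m < p
/1+-<-pos c (mkℚ +[1+ a ] d _) _ =
  m , toℚᵘ-cancel-< (ℚᵘ.≤-<-trans (ℚᵘ.≤-reflexive (toℚᵘ-fromℚᵘ (mkℚᵘ (+ c) m))) (*<* lt))
  where
  m = c ℕ.* suc d
  lt : + c ℤ.* +[1+ d ] ℤ.< +[1+ a ] ℤ.* +[1+ m ]
  lt = subst₂ ℤ._<_ (ℤ.pos-* c (suc d)) (ℤ.pos-* (suc a) (suc m))
         (ℤ.+<+ (ℕ.<-≤-trans (ℕ.n<1+n m) (ℕ.m≤n*m (suc m) (suc a))))

+-/1+-< : ∀ c {r q} → r < q → ∃[ m ] r + c /1+ m < q
+-/1+-< c {r} {q} r<q with /1+-<-pos c (q - r) (positive 0<q-r)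
  where
  0<q-r : 0ℚ < q - r
  0<q-r = subst (_< q - r) (+-inverseʳ r) (+-monoˡ-< (- r) r<q)
... | m , lt = m , subst (r + c /1+ m <_) r+[q-r]≡q (+-monoʳ-< r lt)
  where
  open ℚ-Solver.+-*-Solver
  r+[q-r]≡q : r + (q - r) ≡ q
  r+[q-r]≡q = solve 2 (λ r q → r :+ (q :- r) := q) refl r q

∀≤-+-/1+⇒≤ : ∀ c {q r} → (∀ m → q ≤ r + c /1+ m) → q ≤ r
∀≤-+-/1+⇒≤ c {q} {r} q≤r+ε = decidable-stable (q ≤? r) λ q≰r →
  let m , r+ε<q = +-/1+-< c (≰⇒> q≰r) in <-irrefl refl (≤-<-trans (q≤r+ε m) r+ε<q)

∣p-q∣≡∣q-p∣ : ∀ p q → ∣ p - q ∣ ≡ ∣ q - p ∣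
∣p-q∣≡∣q-p∣ p q = trans (cong ∣_∣ p-q≡-[q-p]) (∣-p∣≡∣p∣ (q - p))
  where
  open ℚ-Solver.+-*-Solver
  p-q≡-[q-p] : p - q ≡ - (q - p)
  p-q≡-[q-p] = solve 2 (λ p q → p :- q := :- (q :- p)) refl p q

∣p-r∣≤∣p-q∣+∣q-r∣ : ∀ p q r → ∣ p - r ∣ ≤ ∣ p - q ∣ + ∣ q - r ∣
∣p-r∣≤∣p-q∣+∣q-r∣ p q r = subst (λ x → ∣ x ∣ ≤ ∣ p - q ∣ + ∣ q - r ∣) telescope (∣p+q∣≤∣p∣+∣q∣ (p - q) (q - r))
  where
  open ℚ-Solver.+-*-Solver
  telescope : (p - q) + (q - r) ≡ p - r
  telescope = solve 3 (λ p q r → (p :- q) :+ (q :- r) := p :- r) refl p q r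

∣p-s∣≤∣p-q∣+∣q-r∣+∣r-s∣ : ∀ p q r s → ∣ p - s ∣ ≤ ∣ p - q ∣ + ∣ q - r ∣ + ∣ r - s ∣
∣p-s∣≤∣p-q∣+∣q-r∣+∣r-s∣ p q r s = ≤-trans (∣p-r∣≤∣p-q∣+∣q-r∣ p r s) (+-monoˡ-≤ ∣ r - s ∣ (∣p-r∣≤∣p-q∣+∣q-r∣ p q r))

=ℝ-refl : ∀ x → x =ℝ x
=ℝ-refl x n = subst (_≤ 2 /1+ n) (sym (cong ∣_∣ (+-inverseʳ (seq x n)))) (0≤/1+ 2 n)

=ℝ-sym : ∀ {x y} → x =ℝ y → y =ℝ x
=ℝ-sym {x} {y} x=y n = subst (_≤ 2 /1+ n) (∣p-q∣≡∣q-p∣ (seq x n) (seq y n)) (x=y n)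

dist : ℝ → ℝ → ℕ → ℚ
dist x y n = ∣ seq x n - seq y n ∣

dist-reindex : ∀ x y n m → dist x y n ≤ dist x y m + (2 /1+ n + 2 /1+ m)
dist-reindex x y n m = begin
  dist x y n                                                            ≤⟨ ∣p-s∣≤∣p-q∣+∣q-r∣+∣r-s∣ (seq x n) (seq x m) (seq y m) (seq y n) ⟩
  ∣ seq x n - seq x m ∣ + dist x y m + ∣ seq y m - seq y n ∣            ≤⟨ +-mono-≤ (+-monoˡ-≤ (dist x y m) (reg x n m)) (reg y m n) ⟩
  (1 /1+ n + 1 /1+ m) + dist x y m + (1 /1+ m + 1 /1+ n)                ≡⟨ rearrange (1 /1+ n) (1 /1+ m) (dist x y m) ⟩
  dist x y m + ((+ 2 / 1) * 1 /1+ n + (+ 2 / 1) * 1 /1+ m)              ≡⟨ cong₂ (λ a b → dist x y m + (a + b)) (/1+-scale 2 n) (/1+-scale 2 m) ⟨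
  dist x y m + (2 /1+ n + 2 /1+ m)                                      ∎
  where
  open ≤-Reasoning
  open ℚ-Solver.+-*-Solver
  rearrange : ∀ u v d → (u + v) + d + (v + u) ≡ d + ((+ 2 / 1) * u + (+ 2 / 1) * v)
  rearrange = solve 3 (λ u v d → (u :+ v) :+ d :+ (v :+ u) := d :+ (con (+ 2 / 1) :* u :+ con (+ 2 / 1) :* v)) refl

dist-resp-=ℝ : ∀ {x x' y y'} → x =ℝ x' → y =ℝ y' → ∀ m → dist x y m ≤ dist x' y' m + 4 /1+ m
dist-resp-=ℝ {x} {x'} {y} {y'} x=x' y=y' m = begin
  dist x y m                                                            ≤⟨ ∣p-s∣≤∣p-q∣+∣q-r∣+∣r-s∣ (seq x m) (seq x' m) (seq y' m) (seq y m) ⟩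
  dist x x' m + dist x' y' m + dist y' y m                              ≤⟨ +-mono-≤ (+-monoˡ-≤ (dist x' y' m) (x=x' m)) (=ℝ-sym {y} {y'} y=y' m) ⟩
  2 /1+ m + dist x' y' m + 2 /1+ m                                      ≡⟨ cong (λ a → a + dist x' y' m + a) (/1+-scale 2 m) ⟩
  (+ 2 / 1) * 1 /1+ m + dist x' y' m + (+ 2 / 1) * 1 /1+ m              ≡⟨ rearrange (1 /1+ m) (dist x' y' m) ⟩
  dist x' y' m + (+ 4 / 1) * 1 /1+ m                                    ≡⟨ cong (λ a → dist x' y' m + a) (/1+-scale 4 m) ⟨
  dist x' y' m + 4 /1+ m                                                ∎
  where
  open ≤-Reasoning
  open ℚ-Solver.+-*-Solver
  rearrange : ∀ v d → (+ 2 / 1) * v + d + (+ 2 / 1) * v ≡ d + (+ 4 / 1) * v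
  rearrange = solve 2 (λ v d → con (+ 2 / 1) :* v :+ d :+ con (+ 2 / 1) :* v := d :+ con (+ 4 / 1) :* v) refl

dist-≤-dist-=ℝ : ∀ {x x' y y'} → x =ℝ x' → y =ℝ y' →
                 ∀ n m → dist x y n ≤ dist x' y' m + (2 /1+ n + 6 /1+ m)
dist-≤-dist-=ℝ {x} {x'} {y} {y'} x=x' y=y' n m = begin
  dist x y n                                                            ≤⟨ dist-reindex x y n m ⟩
  dist x y m + (2 /1+ n + 2 /1+ m)                                      ≤⟨ +-monoˡ-≤ (2 /1+ n + 2 /1+ m) (dist-resp-=ℝ {x} {x'} {y} {y'} x=x' y=y' m) ⟩
  d + 4 /1+ m + (2 /1+ n + 2 /1+ m)                                     ≡⟨ cong₂ (λ a b → d + a + (2 /1+ n + b)) (/1+-scale 4 m) (/1+-scale 2 m) ⟩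
  d + (+ 4 / 1) * 1 /1+ m + (2 /1+ n + (+ 2 / 1) * 1 /1+ m)             ≡⟨ rearrange (2 /1+ n) (1 /1+ m) d ⟩
  d + (2 /1+ n + (+ 6 / 1) * 1 /1+ m)                                   ≡⟨ cong (λ a → d + (2 /1+ n + a)) (/1+-scale 6 m) ⟨
  d + (2 /1+ n + 6 /1+ m)                                               ∎
  where
  open ≤-Reasoning
  open ℚ-Solver.+-*-Solver
  d = dist x' y' m
  rearrange : ∀ w v d → d + (+ 4 / 1) * v + (w + (+ 2 / 1) * v) ≡ d + (w + (+ 6 / 1) * v)
  rearrange = solve 3 (λ w v d → d :+ con (+ 4 / 1) :* v :+ (w :+ con (+ 2 / 1) :* v) := d :+ (w :+ con (+ 6 / 1) :* v)) refl

=ℝ-trans : ∀ {x y z} → x =ℝ y → y =ℝ z → x =ℝ z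
=ℝ-trans {x} {y} {z} x=y y=z n = ∀≤-+-/1+⇒≤ 6 λ m →
  subst (dist x z n ≤_) (dist-self+ε≡ε (seq y m) _) (dist-≤-dist-=ℝ {x} {y} {z} {y} x=y (=ℝ-sym {y} {z} y=z) n m)
  where
  dist-self+ε≡ε : ∀ p ε → ∣ p - p ∣ + ε ≡ ε
  dist-self+ε≡ε p ε = trans (cong (λ a → ∣ a ∣ + ε) (+-inverseʳ p)) (+-identityˡ ε)

-- x ≠ℝ y compares 1/(k+1) with the terms of index 2k+1. The witness m for x' ≠ℝ y' is chosen
-- so that the error 2/(2k+2) + 6/(2m+2) = 1/(k+1) + 3/(m+1) of dist-≤-dist-=ℝ still leaves
-- room 1/(m+1) below dist x y (2k+1).
≠ℝ-resp : ∀ {x x' y y'} → x =ℝ x' → y =ℝ y' → x ≠ℝ y → x' ≠ℝ y'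
≠ℝ-resp {x} {x'} {y} {y'} x=x' y=y' (k , gap) =
  let m , room = +-/1+-< 4 gap
  in m , decidable-stable (1 /1+ m <? dist x' y' (odd m)) λ no-gap →
           <-irrefl refl (<-≤-trans room (bound m (≮⇒≥ no-gap)))
  where
  odd : ℕ → ℕ
  odd n = suc (2 ℕ.* n)
  bound : ∀ m → dist x' y' (odd m) ≤ 1 /1+ m → dist x y (odd k) ≤ 1 /1+ k + 4 /1+ m
  bound m d'≤ = begin
    dist x y (odd k)                                            ≤⟨ dist-≤-dist-=ℝ {x} {x'} {y} {y'} x=x' y=y' (odd k) (odd m) ⟩
    d' + (2 /1+ odd k + 6 /1+ odd m)                            ≡⟨ cong₂ (λ a b → d' + (a + b)) (/1+-halve 1 k) (/1+-halve 3 m) ⟩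
    d' + (1 /1+ k + 3 /1+ m)                                    ≤⟨ +-monoˡ-≤ (1 /1+ k + 3 /1+ m) d'≤ ⟩
    1 /1+ m + (1 /1+ k + 3 /1+ m)                               ≡⟨ cong₂ (λ a b → a + (1 /1+ k + b)) (/1+-scale 1 m) (/1+-scale 3 m) ⟩
    (+ 1 / 1) * 1 /1+ m + (1 /1+ k + (+ 3 / 1) * 1 /1+ m)       ≡⟨ rearrange (1 /1+ k) (1 /1+ m) ⟩
    1 /1+ k + (+ 4 / 1) * 1 /1+ m                               ≡⟨ cong (λ a → 1 /1+ k + a) (/1+-scale 4 m) ⟨
    1 /1+ k + 4 /1+ m                                           ∎
    where
    open ≤-Reasoning
    open ℚ-Solver.+-*-Solver
    d' = dist x' y' (odd m)
    rearrange : ∀ u v → (+ 1 / 1) * v + (u + (+ 3 / 1) * v) ≡ u + (+ 4 / 1) * v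
    rearrange = solve 2 (λ u v → con (+ 1 / 1) :* v :+ (u :+ con (+ 3 / 1) :* v) := u :+ con (+ 4 / 1) :* v) refl

module _ {I : CompletelySeparated} (S : Family I) where
  open PiSet S
  open Family S

  comp-pr∈⊗F : ∀ i f → mem (F i) f → ⊗F (comp-pr i f)
  comp-pr∈⊗F i f f∈Fᵢ = i , f , f∈Fᵢ , λ a → =ℝ-refl (ap f (Θ a i))

  ⊗F-isExtensional : IsExtensional ⊗F
  ⊗F-isExtensional g h g=h (i , f , f∈Fᵢ , g=f∘prᵢ) =
    i , f , f∈Fᵢ , λ a → =ℝ-trans {ap h a} {ap g a} {ap f (Θ a i)} (=ℝ-sym {ap g a} {ap h a} (g=h a)) (g=f∘prᵢ a)

  ≠Π⇒≠⊗F : ∀ a b → a ≠Π b → NeqF ⊗F a b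
  ≠Π⇒≠⊗F a b (i , aᵢ≠bᵢ) =
    let f , f∈Fᵢ , faᵢ≠fbᵢ = Equivalence.to (sep i (Θ a i) (Θ b i)) aᵢ≠bᵢ
    in comp-pr i f , comp-pr∈⊗F i f f∈Fᵢ , faᵢ≠fbᵢ

  ≠⊗F⇒≠Π : ∀ a b → NeqF ⊗F a b → a ≠Π b
  ≠⊗F⇒≠Π a b (g , (i , f , f∈Fᵢ , g=f∘prᵢ) , ga≠gb) =
    i , Equivalence.from (sep i (Θ a i) (Θ b i)) (f , f∈Fᵢ , ≠ℝ-resp {ap g a} {ap f (Θ a i)} {ap g b} {ap f (Θ b i)} (g=f∘prᵢ a) (g=f∘prᵢ b) ga≠gb)

  ⊗F-tight : ∀ a b → EqF ⊗F a b → a =Π b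
  ⊗F-tight a b a=b i = tight i (Θ a i) (Θ b i) λ f f∈Fᵢ → a=b (comp-pr i f) (comp-pr∈⊗F i f f∈Fᵢ)

proposition4p5 : (I : CompletelySeparated) (S : Family I) →
    IsCompletelySeparated (PiSet.ΠSet S) (PiSet.⊗F S)
proposition4p5 I S =
  ⊗F-isExtensional S , (λ a b → mk⇔ (≠Π⇒≠⊗F S a b) (≠⊗F⇒≠Π S a b)) , ⊗F-tight S
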